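{- Let $\psi=(B_1,\dots,B_p)$ and $\phi=(C_1,\dots,C_q)$ be weak linear orders of a finite set $V$, and run the procedure Refine$(\psi,\phi)$ described in the context. If it returns a weak linear order $\Phi$ of $V$, then $\Phi$ is the common refinement $\psi\wedge\phi$. If it returns $\Phi=\emptyset$, then $\psi$ and $\phi$ are not compatible.
   Context: A weak linear order on $V$ is an ordered partition $(B_1,\dots,B_p)$ of $V$, with $x=_\psi y$ iff same class and $x<_\psi y$ iff $x\in B_i,y\in B_j$, $i<j$. $\psi[U]$ denotes restriction to $U\subseteq V$; $(\psi_1,\psi_2)$ denotes concatenation of weak orders on disjoint sets. Two weak linear orders $\psi,\phi$ on $V$ are compatible if there are no $x,y$ with $x<_\psi y$ and $y<_\phi x$; their common refinement $\psi\wedge\phi$ is defined by $x=y$ iff $x=_\psi y$ and $x=_\phi y$, and $x<y$ iff $x\le_\psi y$ and $x\le_\phi y$ with at least one strict. Procedure Refine$(\psi,\phi)$: let $B^{\max}$ be the last block of $\psi$ meeting $C_1$. If some block $B$ of $\psi$ with $B<_\psi B^{\max}$ satisfies $B\not\subseteq C_1$, set $\Phi=\emptyset$. Otherwise let $W=V\setminus C_1$; if $W=\emptyset$ set $\Phi=\psi[C_1]$, else set $\Phi=(\psi[C_1],\mathrm{Refine}(\psi[W],\phi[W]))$ (concatenation; if the recursive call returns $\emptyset$ this concatenation is just $\psi[C_1]$). Finally, if $\Phi$ is a weak linear order of all of $V$ return $\Phi$, else return $\emptyset$. -}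

module Defs where

open import Data.Nat using (ℕ; zero; suc)
open import Data.Bool using (Bool; true; false; if_then_else_; not; _∧_)
open import Data.Maybe using (Maybe; just; nothing; maybe)
open import Data.List using (List; []; _∷_; _++_; filter; map; concat; length; lookup; null)
open import Data.Bool.ListAction using (all; any)
open import Data.List.Relation.Binary.Permutation.Propositional using (_↭_)
open import Data.Fin as Fin using (Fin)
open import Data.Product using (Σ; _×_; ∃-syntax; _,_)
open import Data.Sum using (_⊎_)
open import Relation.Binary.PropositionalEquality using (_≡_; _≢_)
open import Relation.Binary.Definitions using (DecidableEquality)
open import Relation.Nullary using (¬_; ¬?; does)
open import Function.Bundles using (_⇔_)

-- Weak linear orders on a finite set of elements of a type A with decidable
-- equality.  A finite set V is a duplicate-free list; a weak linear order is
-- an ordered list of blocks (B₁,…,Bₚ).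
module WLO {A : Set} (_≟_ : DecidableEquality A) where

  open import Data.List.Membership.DecPropositional _≟_ using (_∈_; _∈?_)
  open import Data.List.Relation.Unary.Unique.DecPropositional _≟_ using (Unique; unique?)

  WeakOrder : Set
  WeakOrder = List (List A)

  IsWLO : List A → WeakOrder → Set
  IsWLO V ψ = (∀ (i : Fin (length ψ)) → lookup ψ i ≢ []) × (concat ψ ↭ V)

  _=[_]_ : A → WeakOrder → A → Set
  x =[ ψ ] y = Σ (Fin (length ψ)) λ i → x ∈ lookup ψ i × y ∈ lookup ψ i

  _<[_]_ : A → WeakOrder → A → Set
  x <[ ψ ] y = Σ (Fin (length ψ)) λ i → Σ (Fin (length ψ)) λ j →
               i Fin.< j × x ∈ lookup ψ i × y ∈ lookup ψ j

  _≤[_]_ : A → WeakOrder → A → Set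
  x ≤[ ψ ] y = x <[ ψ ] y ⊎ x =[ ψ ] y

  Compatible : WeakOrder → WeakOrder → Set
  Compatible ψ φ = ¬ (∃[ x ] ∃[ y ] (x <[ ψ ] y × y <[ φ ] x))

  IsCommonRefinement : List A → WeakOrder → WeakOrder → WeakOrder → Set
  IsCommonRefinement V ψ φ Φ =
    IsWLO V Φ ×
    (∀ x y → x ∈ V → y ∈ V →
      ((x =[ Φ ] y) ⇔ (x =[ ψ ] y × x =[ φ ] y)) ×
      ((x <[ Φ ] y) ⇔ (x ≤[ ψ ] y × x ≤[ φ ] y × (x <[ ψ ] y ⊎ x <[ φ ] y))))

  restrict : WeakOrder → List A → WeakOrder
  restrict ψ U = filter (λ B → ¬? (B ≟ₗ [])) (map (filter (λ x → x ∈? U)) ψ)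
    where
    open import Data.List.Properties using (≡-dec)
    _≟ₗ_ : DecidableEquality (List A)
    _≟ₗ_ = ≡-dec _≟_

  _∖_ : List A → List A → List A
  V ∖ C = filter (λ x → ¬? (x ∈? C)) V

  meetsᵇ : List A → List A → Bool
  meetsᵇ B C = any (λ x → does (x ∈? C)) B

  subsetᵇ : List A → List A → Bool
  subsetᵇ B C = all (λ x → does (x ∈? C)) B

  -- the blocks of ψ strictly before B^max, the last block of ψ meeting C
  -- (nothing if no block of ψ meets C)
  blocksBeforeLastMeeting : List A → WeakOrder → Maybe WeakOrder
  blocksBeforeLastMeeting C [] = nothing
  blocksBeforeLastMeeting C (B ∷ ψ) with blocksBeforeLastMeeting C ψ
  ... | just pre = just (B ∷ pre)
  ... | nothing  = if meetsᵇ B C then just [] else nothing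

  isWLOᵇ : List A → WeakOrder → Bool
  isWLOᵇ V Φ = all (λ B → not (null B)) Φ
             ∧ does (unique? (concat Φ))
             ∧ all (λ x → does (x ∈? V)) (concat Φ)
             ∧ all (λ x → does (x ∈? concat Φ)) V

  -- Refine with a fuel argument (the length of φ suffices: each recursive
  -- call removes the block C₁ of φ).  Result `nothing` is Φ = ∅.
  refine : ℕ → List A → WeakOrder → WeakOrder → Maybe WeakOrder
  refine _ V ψ [] = if isWLOᵇ V [] then just [] else nothing
  refine zero V ψ (C₁ ∷ φ') = nothing
  refine (suc n) V ψ (C₁ ∷ φ') with blocksBeforeLastMeeting C₁ ψ
  ... | nothing  = nothing
  ... | just pre =
    if any (λ B → not (subsetᵇ B C₁)) pre then nothing
    else finalCheck
    where
    φ : WeakOrder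
    φ = C₁ ∷ φ'
    W : List A
    W = V ∖ C₁
    Φ : WeakOrder
    Φ = if null W then restrict ψ C₁
        else (restrict ψ C₁ ++ maybe (λ R → R) [] (refine n W (restrict ψ W) (restrict φ W)))
    finalCheck : Maybe WeakOrder
    finalCheck = if isWLOᵇ V Φ then just Φ else nothing

  Refine : List A → WeakOrder → WeakOrder → Maybe WeakOrder
  Refine V ψ φ = refine (length φ) V ψ φ

-- Write x ≼ y for x < y or x = y.  The blocks of a weak order of a duplicate-free V are
-- disjoint, so = and < are recovered from ≼ (x = y iff x ≼ y ≼ x; x < y iff x ≼ y and not
-- y ≼ x), and ψ ∧ φ is the weak order of V whose ≼ is the intersection of ≼_ψ and ≼_φ.
--
-- Refine recurses only when C₁ is a down-set of ψ (every block before the last one meeting C₁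
-- lies in C₁).  Then Φ = (ψ[C₁], ψ[W] ∧ φ[W]) with W = V ∖ C₁ has the right ≼: inside C₁ it is
-- ≼_ψ, and φ puts C₁ in a single block; from C₁ to W it holds, as it does in φ, which starts
-- with C₁, and in ψ, by the down-set property; from W to C₁ it fails in Φ and in φ; inside W it
-- is the recursive meet.  If the test fails, some z ∉ C₁ precedes some x ∈ C₁ in ψ, while
-- x <_φ z.  A conflict found recursively on W is one of ψ and φ, and the final check then
-- rejects Φ, which misses the nonempty W.

module Submission where

open import Data.Bool using (Bool; true; false; T; not; if_then_else_)
open import Data.Bool.ListAction using (all; any)
open import Data.Empty using (⊥; ⊥-elim)
open import Data.Fin using (zero; suc)
open import Data.List using (List; []; _∷_; _++_; filter; map; concat; length; lookup; null)
open import Data.List.Properties using (≡-dec; concat-++; filter-++; filter-none; length-filter; length-map; ++-identityʳ; partition-defn)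
open import Data.List.Membership.Propositional using (_∈_; _∉_; find)
open import Data.List.Membership.Propositional.Properties using (∈-++⁺ˡ; ∈-++⁺ʳ; ∈-++⁻; ∈-filter⁺; ∈-filter⁻; ∈-lookup)
open import Data.List.Relation.Binary.Permutation.Propositional using (_↭_; ↭-refl; ↭-sym; ↭-trans; ↭⇒↭ₛ; ↭ₛ⇒↭)
open import Data.List.Relation.Binary.Permutation.Propositional.Properties using (∈-resp-↭; filter-↭; ++⁺; ↭-empty-inv)
import Data.List.Relation.Binary.Permutation.Setoid.Properties as PermutationSetoid
open import Data.List.Relation.Unary.All as All using (All; []; _∷_)
open import Data.List.Relation.Unary.All.Properties using (all⁺; all⁻; all-filter; ¬Any⇒All¬; ¬All⇒Any¬)
import Data.List.Relation.Unary.All.Properties as All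
open import Data.List.Relation.Unary.Any as Any using (Any; here; there)
open import Data.List.Relation.Unary.Any.Properties using (any⁺; any⁻; lookup-index)
import Data.List.Relation.Unary.Any.Properties as Any
open import Data.List.Relation.Unary.Unique.Propositional using (Unique; _∷_)
import Data.List.Relation.Unary.Unique.Propositional.Properties as Unique
open import Data.Maybe using (Maybe; just; nothing; maybe)
open import Data.Nat using (zero; suc; _≤_; z≤n; s≤s)
open import Data.Nat.Properties using (≤-refl; ≤-trans; ≤-reflexive)
open import Data.Product using (∃; ∃₂; _×_; _,_; proj₁; proj₂; swap)
import Data.Product as Product
open import Data.Product.Function.NonDependent.Propositional using (_×-⇔_)
open import Data.Sum using (_⊎_; inj₁; inj₂; [_,_])
import Data.Sum as Sum
open import Data.Sum.Function.Propositional using (_⊎-⇔_)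
open import Function using (_∘_; const)
open import Function.Bundles using (_⇔_; mk⇔; Equivalence)
open import Function.Properties.Equivalence using (⇔-setoid)
open import Level using (0ℓ)
open import Relation.Binary.Definitions using (DecidableEquality)
open import Relation.Binary.PropositionalEquality using (_≡_; _≢_; refl; sym; trans; cong; subst; setoid)
open import Relation.Nullary using (¬_; ¬?; proof; yes; no)
open import Relation.Nullary.Decidable using (decidable-stable)
open import Relation.Nullary.Reflects using (Reflects; ofʸ; ofⁿ; fromEquivalence; ¬-reflects; _×-reflects_)
open import Relation.Unary using (Decidable)
open import Relation.Unary.Properties using (∁?)

open import Defs

open Equivalence using (to; from)

-- Lists and boolean reflection

module _ {X : Set} where

  reflects⇒ : ∀ {P : Set} {b} → Reflects P b → T b → P
  reflects⇒ (ofʸ p) _ = p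

  reflects⇐ : ∀ {P : Set} {b} → Reflects P b → P → T b
  reflects⇐ (ofʸ _) _ = _
  reflects⇐ (ofⁿ ¬p) p = ¬p p

  any-reflects : ∀ {P : X → Set} {p : X → Bool} → (∀ x → Reflects (P x) (p x)) →
                 ∀ xs → Reflects (Any P xs) (any p xs)
  any-reflects r xs = fromEquivalence (Any.map (λ {x} → reflects⇒ (r x)) ∘ any⁻ _ xs)
                                      (any⁺ _ ∘ Any.map (λ {x} → reflects⇐ (r x)))

  all-reflects : ∀ {P : X → Set} {p : X → Bool} → (∀ x → Reflects (P x) (p x)) →
                 ∀ xs → Reflects (All P xs) (all p xs)
  all-reflects r xs = fromEquivalence (All.map (λ {x} → reflects⇒ (r x)) ∘ all⁺ _ xs)
                                      (all⁻ _ ∘ All.map (λ {x} → reflects⇐ (r x)))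

  null-reflects : ∀ (xs : List X) → Reflects (xs ≡ []) (null xs)
  null-reflects []      = ofʸ refl
  null-reflects (_ ∷ _) = ofⁿ λ ()

  lookup⇔Any : ∀ {P : X → Set} xs → (∃ λ i → P (lookup xs i)) ⇔ Any P xs
  lookup⇔Any {P} xs = mk⇔ (fromLookup xs) (λ p → Any.index p , lookup-index p)
    where
    fromLookup : ∀ xs → (∃ λ i → P (lookup xs i)) → Any P xs
    fromLookup (x ∷ xs) (zero , p)  = here p
    fromLookup (x ∷ xs) (suc i , p) = there (fromLookup xs (i , p))

  lookup⇔All : ∀ {P : X → Set} xs → (∀ i → P (lookup xs i)) ⇔ All P xs
  lookup⇔All {P} xs = mk⇔ (fromLookup xs) (λ pxs i → All.lookup pxs (∈-lookup i))
    where
    fromLookup : ∀ xs → (∀ i → P (lookup xs i)) → All P xs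
    fromLookup []       _ = []
    fromLookup (x ∷ xs) f = f zero ∷ fromLookup xs (f ∘ suc)

  filter-cong-∈ : ∀ {P Q : X → Set} (P? : Decidable P) (Q? : Decidable Q) {xs} →
                  (∀ {x} → x ∈ xs → P x → Q x) → (∀ {x} → x ∈ xs → Q x → P x) →
                  filter P? xs ≡ filter Q? xs
  filter-cong-∈ P? Q? {[]}     _   _   = refl
  filter-cong-∈ P? Q? {x ∷ xs} P⇒Q Q⇒P with P? x | Q? x
  ... | yes _  | yes _  = cong (x ∷_) (filter-cong-∈ P? Q? (P⇒Q ∘ there) (Q⇒P ∘ there))
  ... | no  _  | no  _  = filter-cong-∈ P? Q? (P⇒Q ∘ there) (Q⇒P ∘ there)
  ... | yes px | no ¬qx = ⊥-elim (¬qx (P⇒Q (here refl) px))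
  ... | no ¬px | yes qx = ⊥-elim (¬px (Q⇒P (here refl) qx))

  filter-++-filter-∁-↭ : ∀ {P : X → Set} (P? : Decidable P) xs → xs ↭ filter P? xs ++ filter (∁? P?) xs
  filter-++-filter-∁-↭ P? xs =
    subst (λ (ys , zs) → xs ↭ ys ++ zs) (partition-defn P? xs)
          (↭ₛ⇒↭ (PermutationSetoid.partition-↭ (setoid X) P? xs))

  ++-disjoint : ∀ xs {ys} {x : X} → Unique (xs ++ ys) → x ∈ xs → x ∈ ys → ⊥
  ++-disjoint (_ ∷ xs) (x≢ ∷ _) (here refl) x∈ys = All.lookup x≢ (∈-++⁺ʳ xs x∈ys) refl
  ++-disjoint (_ ∷ xs) (_ ∷ u)  (there x∈xs) x∈ys = ++-disjoint xs u x∈xs x∈ys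

  ≢[]⇒∈ : ∀ (xs : List X) → xs ≢ [] → ∃ (_∈ xs)
  ≢[]⇒∈ []      xs≢[] = ⊥-elim (xs≢[] refl)
  ≢[]⇒∈ (x ∷ _) _     = x , here refl

  ++-uniqueʳ : ∀ xs {ys : List X} → Unique (xs ++ ys) → Unique ys
  ++-uniqueʳ []       u       = u
  ++-uniqueʳ (_ ∷ xs) (_ ∷ u) = ++-uniqueʳ xs u

module _ {A : Set} (_≟_ : DecidableEquality A) where

  open WLO _≟_
  open import Data.List.Membership.DecPropositional _≟_ using (_∈?_)
  open import Data.List.Relation.Unary.Unique.DecPropositional _≟_ using (unique?)
  open PermutationSetoid (setoid A) using (Unique-resp-↭)

  -- The block relations of a weak order

  SameBlock : WeakOrder → A → A → Set
  SameBlock ψ x y = Any (λ B → x ∈ B × y ∈ B) ψ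

  data Precedes : WeakOrder → A → A → Set where
    first : ∀ {B ψ x y} → x ∈ B → y ∈ concat ψ → Precedes (B ∷ ψ) x y
    later : ∀ {B ψ x y} → Precedes ψ x y → Precedes (B ∷ ψ) x y

  WeaklyPrecedes : WeakOrder → A → A → Set
  WeaklyPrecedes ψ x y = Precedes ψ x y ⊎ SameBlock ψ x y

  Conflict : WeakOrder → WeakOrder → Set
  Conflict ψ φ = ∃₂ λ x y → Precedes ψ x y × Precedes φ y x

  IsWeakOrderOf : List A → WeakOrder → Set
  IsWeakOrderOf V ψ = All (_≢ []) ψ × concat ψ ↭ V

  sameBlock⇔ : ∀ {ψ x y} → x =[ ψ ] y ⇔ SameBlock ψ x y
  sameBlock⇔ {ψ} = lookup⇔Any ψ

  precedes⇔ : ∀ {ψ x y} → x <[ ψ ] y ⇔ Precedes ψ x y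
  precedes⇔ {ψ} = mk⇔ (fromIndices ψ) toIndices
    where
    fromIndices : ∀ ψ {x y} → x <[ ψ ] y → Precedes ψ x y
    fromIndices (B ∷ ψ) (zero , suc j , _ , x∈ , y∈) = first x∈ (Any.concat⁺ (to (lookup⇔Any ψ) (j , y∈)))
    fromIndices (B ∷ ψ) (suc i , suc j , s≤s i<j , x∈ , y∈) = later (fromIndices ψ (i , j , i<j , x∈ , y∈))

    toIndices : ∀ {ψ x y} → Precedes ψ x y → x <[ ψ ] y
    toIndices {_ ∷ ψ} (first x∈ y∈) =
      let y∈B = Any.concat⁻ ψ y∈ in zero , suc (Any.index y∈B) , s≤s z≤n , x∈ , lookup-index y∈B
    toIndices (later p) =
      let i , j , i<j , x∈ , y∈ = toIndices p in suc i , suc j , s≤s i<j , x∈ , y∈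

  weaklyPrecedes⇔ : ∀ {ψ x y} → x ≤[ ψ ] y ⇔ WeaklyPrecedes ψ x y
  weaklyPrecedes⇔ = precedes⇔ ⊎-⇔ sameBlock⇔

  isWLO⇔ : ∀ {V ψ} → IsWLO V ψ ⇔ IsWeakOrderOf V ψ
  isWLO⇔ {ψ = ψ} = mk⇔ (Product.map₁ (to (lookup⇔All ψ))) (Product.map₁ (from (lookup⇔All ψ)))

  conflict⇒¬compatible : ∀ {ψ φ} → Conflict ψ φ → ¬ Compatible ψ φ
  conflict⇒¬compatible (x , y , p , q) compatible =
    compatible (x , y , from precedes⇔ p , from precedes⇔ q)

  sameBlock-sym : ∀ {ψ x y} → SameBlock ψ x y → SameBlock ψ y x
  sameBlock-sym = Any.map swap

  sameBlock⇒∈ : ∀ {ψ x y} → SameBlock ψ x y → x ∈ concat ψ × y ∈ concat ψ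
  sameBlock⇒∈ s = Any.concat⁺ (Any.map proj₁ s) , Any.concat⁺ (Any.map proj₂ s)

  precedes⇒∈ : ∀ {ψ x y} → Precedes ψ x y → x ∈ concat ψ × y ∈ concat ψ
  precedes⇒∈ {B ∷ _} (first x∈ y∈) = ∈-++⁺ˡ x∈ , ∈-++⁺ʳ B y∈
  precedes⇒∈ {B ∷ _} (later p)     = Product.map (∈-++⁺ʳ B) (∈-++⁺ʳ B) (precedes⇒∈ p)

  precedes⇒∈later : ∀ {B ψ x y} → Precedes (B ∷ ψ) x y → y ∈ concat ψ
  precedes⇒∈later (first _ y∈) = y∈
  precedes⇒∈later (later p)    = proj₂ (precedes⇒∈ p)

  weaklyPrecedes⇒∈ : ∀ {ψ x y} → WeaklyPrecedes ψ x y → x ∈ concat ψ × y ∈ concat ψ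
  weaklyPrecedes⇒∈ = [ precedes⇒∈ , sameBlock⇒∈ ]

  weaklyPrecedes-total : ∀ ψ {x y} → x ∈ concat ψ → y ∈ concat ψ →
                         WeaklyPrecedes ψ x y ⊎ Precedes ψ y x
  weaklyPrecedes-total (B ∷ ψ) x∈ y∈ with ∈-++⁻ B x∈ | ∈-++⁻ B y∈
  ... | inj₁ x∈B | inj₁ y∈B = inj₁ (inj₂ (here (x∈B , y∈B)))
  ... | inj₁ x∈B | inj₂ y∈ψ = inj₁ (inj₁ (first x∈B y∈ψ))
  ... | inj₂ x∈ψ | inj₁ y∈B = inj₂ (first y∈B x∈ψ)
  ... | inj₂ x∈ψ | inj₂ y∈ψ =
    Sum.map (Sum.map later there) later (weaklyPrecedes-total ψ x∈ψ y∈ψ)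

  precedes-asym : ∀ {ψ x y} → Unique (concat ψ) → Precedes ψ x y → ¬ WeaklyPrecedes ψ y x
  precedes-asym {B ∷ _} u (first x∈B y∈ψ) (inj₁ (first y∈B _)) = ++-disjoint B u y∈B y∈ψ
  precedes-asym {B ∷ _} u (first x∈B _)   (inj₁ (later q))     = ++-disjoint B u x∈B (proj₂ (precedes⇒∈ q))
  precedes-asym {B ∷ _} u (first x∈B y∈ψ) (inj₂ (here (y∈B , _))) = ++-disjoint B u y∈B y∈ψ
  precedes-asym {B ∷ _} u (first x∈B _)   (inj₂ (there s))     = ++-disjoint B u x∈B (proj₂ (sameBlock⇒∈ s))
  precedes-asym {B ∷ _} u (later p) (inj₁ (first y∈B _))        = ++-disjoint B u y∈B (proj₂ (precedes⇒∈ p))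
  precedes-asym {B ∷ _} u (later p) (inj₁ (later q))            = precedes-asym (++-uniqueʳ B u) p (inj₁ q)
  precedes-asym {B ∷ _} u (later p) (inj₂ (here (y∈B , _)))     = ++-disjoint B u y∈B (proj₂ (precedes⇒∈ p))
  precedes-asym {B ∷ _} u (later p) (inj₂ (there s))            = precedes-asym (++-uniqueʳ B u) p (inj₂ s)

  sameBlock⇔weaklyPrecedes₂ : ∀ {ψ x y} → Unique (concat ψ) →
                              SameBlock ψ x y ⇔ (WeaklyPrecedes ψ x y × WeaklyPrecedes ψ y x)
  sameBlock⇔weaklyPrecedes₂ u = mk⇔ (λ s → inj₂ s , inj₂ (sameBlock-sym s)) λ where
    (inj₂ s , _)   → s
    (inj₁ p , ≤yx) → ⊥-elim (precedes-asym u p ≤yx)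

  precedes⇔strictly : ∀ {ψ x y} → Unique (concat ψ) →
                      Precedes ψ x y ⇔ (WeaklyPrecedes ψ x y × ¬ WeaklyPrecedes ψ y x)
  precedes⇔strictly u = mk⇔ (λ p → inj₁ p , precedes-asym u p) λ where
    (inj₁ p , _)   → p
    (inj₂ s , ≰yx) → ⊥-elim (≰yx (inj₂ (sameBlock-sym s)))

  ∈-concat-++⁻ : ∀ (ψ₁ : WeakOrder) {ψ₂ x} → x ∈ concat (ψ₁ ++ ψ₂) → x ∈ concat ψ₁ ⊎ x ∈ concat ψ₂
  ∈-concat-++⁻ ψ₁ {ψ₂} x∈ = ∈-++⁻ (concat ψ₁) (subst (_ ∈_) (sym (concat-++ ψ₁ ψ₂)) x∈)

  ∈-concat-++⁺ˡ : ∀ (ψ₁ : WeakOrder) {ψ₂ x} → x ∈ concat ψ₁ → x ∈ concat (ψ₁ ++ ψ₂)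
  ∈-concat-++⁺ˡ ψ₁ {ψ₂} x∈ = subst (_ ∈_) (concat-++ ψ₁ ψ₂) (∈-++⁺ˡ x∈)

  ∈-concat-++⁺ʳ : ∀ (ψ₁ : WeakOrder) {ψ₂ x} → x ∈ concat ψ₂ → x ∈ concat (ψ₁ ++ ψ₂)
  ∈-concat-++⁺ʳ ψ₁ {ψ₂} x∈ = subst (_ ∈_) (concat-++ ψ₁ ψ₂) (∈-++⁺ʳ (concat ψ₁) x∈)

  precedes-++⁻ : ∀ ψ₁ {ψ₂ x y} → Precedes (ψ₁ ++ ψ₂) x y →
                 Precedes ψ₁ x y ⊎ (x ∈ concat ψ₁ × y ∈ concat ψ₂) ⊎ Precedes ψ₂ x y
  precedes-++⁻ []       p = inj₂ (inj₂ p)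
  precedes-++⁻ (B ∷ ψ₁) {ψ₂} (first x∈B y∈) with ∈-concat-++⁻ ψ₁ {ψ₂} y∈
  ... | inj₁ y∈ψ₁ = inj₁ (first x∈B y∈ψ₁)
  ... | inj₂ y∈ψ₂ = inj₂ (inj₁ (∈-++⁺ˡ x∈B , y∈ψ₂))
  precedes-++⁻ (B ∷ ψ₁) (later p) =
    Sum.map later (Sum.map₁ (Product.map₁ (∈-++⁺ʳ B))) (precedes-++⁻ ψ₁ p)

  precedes-++⁺ˡ : ∀ {ψ₁ ψ₂ x y} → Precedes ψ₁ x y → Precedes (ψ₁ ++ ψ₂) x y
  precedes-++⁺ˡ {_ ∷ ψ₁} (first x∈B y∈) = first x∈B (∈-concat-++⁺ˡ ψ₁ y∈)
  precedes-++⁺ˡ (later p)      = later (precedes-++⁺ˡ p)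

  precedes-++⁺ʳ : ∀ ψ₁ {ψ₂ x y} → Precedes ψ₂ x y → Precedes (ψ₁ ++ ψ₂) x y
  precedes-++⁺ʳ []       p = p
  precedes-++⁺ʳ (_ ∷ ψ₁) p = later (precedes-++⁺ʳ ψ₁ p)

  precedes-++⁺ : ∀ ψ₁ {ψ₂ x y} → x ∈ concat ψ₁ → y ∈ concat ψ₂ → Precedes (ψ₁ ++ ψ₂) x y
  precedes-++⁺ (B ∷ ψ₁) x∈ y∈ with ∈-++⁻ B x∈
  ... | inj₁ x∈B  = first x∈B (∈-concat-++⁺ʳ ψ₁ y∈)
  ... | inj₂ x∈ψ₁ = later (precedes-++⁺ ψ₁ x∈ψ₁ y∈)

  weaklyPrecedes-++⁻ : ∀ ψ₁ {ψ₂ x y} → WeaklyPrecedes (ψ₁ ++ ψ₂) x y →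
                       WeaklyPrecedes ψ₁ x y ⊎ (x ∈ concat ψ₁ × y ∈ concat ψ₂) ⊎ WeaklyPrecedes ψ₂ x y
  weaklyPrecedes-++⁻ ψ₁ (inj₁ p) = Sum.map inj₁ (Sum.map₂ inj₁) (precedes-++⁻ ψ₁ p)
  weaklyPrecedes-++⁻ ψ₁ (inj₂ s) = Sum.map inj₂ (inj₂ ∘ inj₂) (Any.++⁻ ψ₁ s)

  weaklyPrecedes-++⁺ˡ : ∀ {ψ₁ ψ₂ x y} → WeaklyPrecedes ψ₁ x y → WeaklyPrecedes (ψ₁ ++ ψ₂) x y
  weaklyPrecedes-++⁺ˡ = Sum.map precedes-++⁺ˡ Any.++⁺ˡ

  weaklyPrecedes-++⁺ʳ : ∀ ψ₁ {ψ₂ x y} → WeaklyPrecedes ψ₂ x y → WeaklyPrecedes (ψ₁ ++ ψ₂) x y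
  weaklyPrecedes-++⁺ʳ ψ₁ = Sum.map (precedes-++⁺ʳ ψ₁) (Any.++⁺ʳ ψ₁)

  -- Restriction of a weak order

  nonEmpty? : Decidable (λ (B : List A) → B ≢ [])
  nonEmpty? B = ¬? (≡-dec _≟_ B [])

  dropEmpty : WeakOrder → WeakOrder
  dropEmpty = filter nonEmpty?

  concat-dropEmpty : ∀ ψ → concat (dropEmpty ψ) ≡ concat ψ
  concat-dropEmpty []            = refl
  concat-dropEmpty ([] ∷ ψ)      = concat-dropEmpty ψ
  concat-dropEmpty ((b ∷ B) ∷ ψ) = cong ((b ∷ B) ++_) (concat-dropEmpty ψ)

  precedes-dropEmpty⁻ : ∀ ψ {x y} → Precedes (dropEmpty ψ) x y → Precedes ψ x y
  precedes-dropEmpty⁻ ([] ∷ ψ)      p              = later (precedes-dropEmpty⁻ ψ p)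
  precedes-dropEmpty⁻ ((b ∷ B) ∷ ψ) (first x∈ y∈) = first x∈ (subst (_ ∈_) (concat-dropEmpty ψ) y∈)
  precedes-dropEmpty⁻ ((b ∷ B) ∷ ψ) (later p)     = later (precedes-dropEmpty⁻ ψ p)

  precedes-dropEmpty⁺ : ∀ ψ {x y} → Precedes ψ x y → Precedes (dropEmpty ψ) x y
  precedes-dropEmpty⁺ ([] ∷ ψ)      (later p)     = precedes-dropEmpty⁺ ψ p
  precedes-dropEmpty⁺ ((b ∷ B) ∷ ψ) (first x∈ y∈) = first x∈ (subst (_ ∈_) (sym (concat-dropEmpty ψ)) y∈)
  precedes-dropEmpty⁺ ((b ∷ B) ∷ ψ) (later p)     = later (precedes-dropEmpty⁺ ψ p)

  sameBlock-dropEmpty⁻ : ∀ ψ {x y} → SameBlock (dropEmpty ψ) x y → SameBlock ψ x y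
  sameBlock-dropEmpty⁻ ψ = Any.filter⁻ nonEmpty?

  sameBlock-dropEmpty⁺ : ∀ ψ {x y} → SameBlock ψ x y → SameBlock (dropEmpty ψ) x y
  sameBlock-dropEmpty⁺ ([] ∷ ψ)      (there s) = sameBlock-dropEmpty⁺ ψ s
  sameBlock-dropEmpty⁺ ((b ∷ B) ∷ ψ) (here s)  = here s
  sameBlock-dropEmpty⁺ ((b ∷ B) ∷ ψ) (there s) = there (sameBlock-dropEmpty⁺ ψ s)

  module _ {Q : A → Set} (Q? : Decidable Q) where

    concat-map-filter : ∀ ψ → concat (map (filter Q?) ψ) ≡ filter Q? (concat ψ)
    concat-map-filter []      = refl
    concat-map-filter (B ∷ ψ) =
      trans (cong (filter Q? B ++_) (concat-map-filter ψ)) (sym (filter-++ Q? B (concat ψ)))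

    ∈-concat-map-filter⁻ : ∀ ψ {x} → x ∈ concat (map (filter Q?) ψ) → x ∈ concat ψ × Q x
    ∈-concat-map-filter⁻ ψ x∈ = ∈-filter⁻ Q? (subst (_ ∈_) (concat-map-filter ψ) x∈)

    ∈-concat-map-filter⁺ : ∀ ψ {x} → x ∈ concat ψ → Q x → x ∈ concat (map (filter Q?) ψ)
    ∈-concat-map-filter⁺ ψ x∈ qx = subst (_ ∈_) (sym (concat-map-filter ψ)) (∈-filter⁺ Q? x∈ qx)

    precedes-map-filter⁻ : ∀ ψ {x y} → Precedes (map (filter Q?) ψ) x y → Precedes ψ x y
    precedes-map-filter⁻ (B ∷ ψ) (first x∈ y∈) =
      first (proj₁ (∈-filter⁻ Q? x∈)) (proj₁ (∈-concat-map-filter⁻ ψ y∈))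
    precedes-map-filter⁻ (B ∷ ψ) (later p) = later (precedes-map-filter⁻ ψ p)

    precedes-map-filter⁺ : ∀ ψ {x y} → Q x → Q y → Precedes ψ x y → Precedes (map (filter Q?) ψ) x y
    precedes-map-filter⁺ (B ∷ ψ) qx qy (first x∈ y∈) =
      first (∈-filter⁺ Q? x∈ qx) (∈-concat-map-filter⁺ ψ y∈ qy)
    precedes-map-filter⁺ (B ∷ ψ) qx qy (later p) = later (precedes-map-filter⁺ ψ qx qy p)

    sameBlock-map-filter⁻ : ∀ ψ {x y} → SameBlock (map (filter Q?) ψ) x y → SameBlock ψ x y
    sameBlock-map-filter⁻ ψ s =
      Any.map (Product.map (proj₁ ∘ ∈-filter⁻ Q?) (proj₁ ∘ ∈-filter⁻ Q?)) (Any.map⁻ s)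

    sameBlock-map-filter⁺ : ∀ ψ {x y} → Q x → Q y → SameBlock ψ x y → SameBlock (map (filter Q?) ψ) x y
    sameBlock-map-filter⁺ ψ qx qy s =
      Any.map⁺ (Any.map (Product.map (λ x∈ → ∈-filter⁺ Q? x∈ qx) (λ y∈ → ∈-filter⁺ Q? y∈ qy)) s)

  concat-restrict : ∀ ψ U → concat (restrict ψ U) ≡ filter (_∈? U) (concat ψ)
  concat-restrict ψ U = trans (concat-dropEmpty (map (filter (_∈? U)) ψ)) (concat-map-filter (_∈? U) ψ)

  ∈-concat-restrict⁻ : ∀ ψ U {x} → x ∈ concat (restrict ψ U) → x ∈ U
  ∈-concat-restrict⁻ ψ U x∈ = proj₂ (∈-filter⁻ (_∈? U) {xs = concat ψ} (subst (_ ∈_) (concat-restrict ψ U) x∈))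

  ∈-concat-restrict⁺ : ∀ ψ U {x} → x ∈ concat ψ → x ∈ U → x ∈ concat (restrict ψ U)
  ∈-concat-restrict⁺ ψ U x∈ψ x∈U = subst (_ ∈_) (sym (concat-restrict ψ U)) (∈-filter⁺ (_∈? U) x∈ψ x∈U)

  weaklyPrecedes-restrict⇔ : ∀ ψ U {x y} → x ∈ U → y ∈ U →
                             WeaklyPrecedes (restrict ψ U) x y ⇔ WeaklyPrecedes ψ x y
  weaklyPrecedes-restrict⇔ ψ U x∈U y∈U = mk⇔
    (Sum.map (precedes-map-filter⁻ (_∈? U) ψ ∘ precedes-dropEmpty⁻ ψU)
             (sameBlock-map-filter⁻ (_∈? U) ψ ∘ sameBlock-dropEmpty⁻ ψU))
    (Sum.map (precedes-dropEmpty⁺ ψU ∘ precedes-map-filter⁺ (_∈? U) ψ x∈U y∈U)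
             (sameBlock-dropEmpty⁺ ψU ∘ sameBlock-map-filter⁺ (_∈? U) ψ x∈U y∈U))
    where
    ψU : WeakOrder
    ψU = map (filter (_∈? U)) ψ

  conflict-restrict⁻ : ∀ ψ φ U → Conflict (restrict ψ U) (restrict φ U) → Conflict ψ φ
  conflict-restrict⁻ ψ φ U (x , y , p , q) = x , y , restrict⁻ ψ p , restrict⁻ φ q
    where
    restrict⁻ : ∀ ψ {x y} → Precedes (restrict ψ U) x y → Precedes ψ x y
    restrict⁻ ψ = precedes-map-filter⁻ (_∈? U) ψ ∘ precedes-dropEmpty⁻ (map (filter (_∈? U)) ψ)

  length-restrict : ∀ ψ U → length (restrict ψ U) ≤ length ψ
  length-restrict ψ U =
    ≤-trans (length-filter nonEmpty? (map (filter (_∈? U)) ψ)) (≤-reflexive (length-map (filter (_∈? U)) ψ))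

  restrict-∷-disjoint : ∀ B ψ U → filter (_∈? U) B ≡ [] → restrict (B ∷ ψ) U ≡ restrict ψ U
  restrict-∷-disjoint B ψ U B∩U≡[] = cong (λ B′ → dropEmpty (B′ ∷ map (filter (_∈? U)) ψ)) B∩U≡[]

  length-restrict-∖ : ∀ V C φ → length (restrict (C ∷ φ) (V ∖ C)) ≤ length φ
  length-restrict-∖ V C φ =
    ≤-trans (≤-reflexive (cong length (restrict-∷-disjoint C φ (V ∖ C) C∩W≡[]))) (length-restrict φ (V ∖ C))
    where
    C∩W≡[] : filter (_∈? (V ∖ C)) C ≡ []
    C∩W≡[] = filter-none (_∈? (V ∖ C))
               (All.tabulate λ x∈C x∈W → proj₂ (∈-filter⁻ (λ x → ¬? (x ∈? C)) {xs = V} x∈W) x∈C)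

  unique-concat : ∀ {V ψ} → Unique V → IsWeakOrderOf V ψ → Unique (concat ψ)
  unique-concat u (_ , ψ↭V) = Unique-resp-↭ (↭⇒↭ₛ (↭-sym ψ↭V)) u

  filter-∈-filter : ∀ {P : A → Set} (P? : Decidable P) V → filter (_∈? filter P? V) V ≡ filter P? V
  filter-∈-filter P? V =
    filter-cong-∈ (_∈? filter P? V) P? {V} (λ _ x∈ → proj₂ (∈-filter⁻ P? {xs = V} x∈)) (∈-filter⁺ P?)

  restrict-isWeakOrderOf : ∀ {V ψ} U → IsWeakOrderOf V ψ → IsWeakOrderOf (filter (_∈? U) V) (restrict ψ U)
  restrict-isWeakOrderOf {ψ = ψ} U (_ , ψ↭V) =
    all-filter nonEmpty? (map (filter (_∈? U)) ψ) ,
    subst (_↭ _) (sym (concat-restrict ψ U)) (filter-↭ (_∈? U) ψ↭V)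

  restrict-filter-isWeakOrderOf : ∀ {V ψ} {P : A → Set} (P? : Decidable P) → IsWeakOrderOf V ψ →
                                  IsWeakOrderOf (filter P? V) (restrict ψ (filter P? V))
  restrict-filter-isWeakOrderOf {V} {ψ} P? w =
    subst (λ V′ → IsWeakOrderOf V′ (restrict ψ (filter P? V))) (filter-∈-filter P? V)
          (restrict-isWeakOrderOf (filter P? V) w)

  ++-isWeakOrderOf : ∀ {V₁ V₂ ψ₁ ψ₂} → IsWeakOrderOf V₁ ψ₁ → IsWeakOrderOf V₂ ψ₂ →
                     IsWeakOrderOf (V₁ ++ V₂) (ψ₁ ++ ψ₂)
  ++-isWeakOrderOf {V₁} {V₂} {ψ₁} {ψ₂} (ne₁ , ψ₁↭V₁) (ne₂ , ψ₂↭V₂) =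
    All.++⁺ ne₁ ne₂ , subst (_↭ (V₁ ++ V₂)) (concat-++ ψ₁ ψ₂) (++⁺ ψ₁↭V₁ ψ₂↭V₂)

  ∈V⇒∈concat : ∀ {V ψ x} → IsWeakOrderOf V ψ → x ∈ V → x ∈ concat ψ
  ∈V⇒∈concat (_ , ψ↭V) = ∈-resp-↭ (↭-sym ψ↭V)

  ∉head⇒∈tail : ∀ {V C φ x} → IsWeakOrderOf V (C ∷ φ) → x ∈ V → x ∉ C → x ∈ concat φ
  ∉head⇒∈tail {C = C} w x∈V x∉C with ∈-++⁻ C (∈V⇒∈concat w x∈V)
  ... | inj₁ x∈C = ⊥-elim (x∉C x∈C)
  ... | inj₂ x∈φ = x∈φ

  -- The common refinement

  IsMeet : List A → WeakOrder → WeakOrder → WeakOrder → Set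
  IsMeet V ψ φ Φ = IsWeakOrderOf V Φ ×
    (∀ {x y} → x ∈ V → y ∈ V → WeaklyPrecedes Φ x y ⇔ (WeaklyPrecedes ψ x y × WeaklyPrecedes φ x y))

  isMeet-[] : ∀ {ψ φ} → IsMeet [] ψ φ []
  isMeet-[] = ([] , ↭-refl) , λ ()

  module _ {V ψ φ Φ} (u : Unique V) (wψ : IsWeakOrderOf V ψ) (wφ : IsWeakOrderOf V φ)
           (isMeet : IsMeet V ψ φ Φ) where

    open import Relation.Binary.Reasoning.Setoid (⇔-setoid 0ℓ)

    private
      meet : ∀ {x y} → x ∈ V → y ∈ V →
             WeaklyPrecedes Φ x y ⇔ (WeaklyPrecedes ψ x y × WeaklyPrecedes φ x y)
      meet = proj₂ isMeet

      uψ : Unique (concat ψ)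
      uψ = unique-concat u wψ
      uφ : Unique (concat φ)
      uφ = unique-concat u wφ
      uΦ : Unique (concat Φ)
      uΦ = unique-concat u (proj₁ isMeet)

      interchange : ∀ {P Q R S : Set} → ((P × Q) × (R × S)) ⇔ ((P × R) × (Q × S))
      interchange = mk⇔ (λ ((p , q) , (r , s)) → (p , r) , (q , s)) (λ ((p , r) , (q , s)) → (p , q) , (r , s))

    sameBlock-meet⇔ : ∀ {x y} → x ∈ V → y ∈ V → SameBlock Φ x y ⇔ (SameBlock ψ x y × SameBlock φ x y)
    sameBlock-meet⇔ {x} {y} x∈V y∈V = begin
      SameBlock Φ x y
        ≈⟨ sameBlock⇔weaklyPrecedes₂ uΦ ⟩
      (WeaklyPrecedes Φ x y × WeaklyPrecedes Φ y x)
        ≈⟨ meet x∈V y∈V ×-⇔ meet y∈V x∈V ⟩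
      ((WeaklyPrecedes ψ x y × WeaklyPrecedes φ x y) × (WeaklyPrecedes ψ y x × WeaklyPrecedes φ y x))
        ≈⟨ interchange ⟩
      ((WeaklyPrecedes ψ x y × WeaklyPrecedes ψ y x) × (WeaklyPrecedes φ x y × WeaklyPrecedes φ y x))
        ≈⟨ sameBlock⇔weaklyPrecedes₂ uψ ×-⇔ sameBlock⇔weaklyPrecedes₂ uφ ⟨
      (SameBlock ψ x y × SameBlock φ x y)
        ∎

    precedes-meet⇔ : ∀ {x y} → x ∈ V → y ∈ V → Precedes Φ x y ⇔
                     (WeaklyPrecedes ψ x y × WeaklyPrecedes φ x y × (Precedes ψ x y ⊎ Precedes φ x y))
    precedes-meet⇔ {x} {y} x∈V y∈V = mk⇔ strict⇒ strict⇐
      where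
      strict⇒ : Precedes Φ x y →
                WeaklyPrecedes ψ x y × WeaklyPrecedes φ x y × (Precedes ψ x y ⊎ Precedes φ x y)
      strict⇒ p =
        let x≼Φy , y⋠Φx = to (precedes⇔strictly uΦ) p
            x≼ψy , x≼φy = to (meet x∈V y∈V) x≼Φy
            strictInφ : WeaklyPrecedes ψ y x → Precedes φ x y
            strictInφ y≼ψx = from (precedes⇔strictly uφ)
                               (x≼φy , λ y≼φx → y⋠Φx (from (meet y∈V x∈V) (y≼ψx , y≼φx)))
        in x≼ψy , x≼φy ,
           [ inj₂ ∘ strictInφ , inj₁ ] (weaklyPrecedes-total ψ (∈V⇒∈concat wψ y∈V) (∈V⇒∈concat wψ x∈V))
      strict⇐ : WeaklyPrecedes ψ x y × WeaklyPrecedes φ x y × (Precedes ψ x y ⊎ Precedes φ x y) →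
                Precedes Φ x y
      strict⇐ (x≼ψy , x≼φy , strict) = from (precedes⇔strictly uΦ)
        ( from (meet x∈V y∈V) (x≼ψy , x≼φy)
        , λ y≼Φx → let y≼ψx , y≼φx = to (meet y∈V x∈V) y≼Φx
                   in [ (λ p → precedes-asym uψ p y≼ψx) , (λ p → precedes-asym uφ p y≼φx) ] strict)

    isMeet⇒isCommonRefinement : IsCommonRefinement V ψ φ Φ
    isMeet⇒isCommonRefinement =
      from isWLO⇔ (proj₁ isMeet) , λ x y x∈V y∈V → same x∈V y∈V , strict x∈V y∈V
      where
      same : ∀ {x y} → x ∈ V → y ∈ V → x =[ Φ ] y ⇔ (x =[ ψ ] y × x =[ φ ] y)
      same {x} {y} x∈V y∈V = begin
        x =[ Φ ] y                         ≈⟨ sameBlock⇔ ⟩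
        SameBlock Φ x y                     ≈⟨ sameBlock-meet⇔ x∈V y∈V ⟩
        (SameBlock ψ x y × SameBlock φ x y) ≈⟨ sameBlock⇔ ×-⇔ sameBlock⇔ ⟨
        (x =[ ψ ] y × x =[ φ ] y)           ∎

      strict : ∀ {x y} → x ∈ V → y ∈ V →
               x <[ Φ ] y ⇔ (x ≤[ ψ ] y × x ≤[ φ ] y × (x <[ ψ ] y ⊎ x <[ φ ] y))
      strict {x} {y} x∈V y∈V = begin
        x <[ Φ ] y
          ≈⟨ precedes⇔ ⟩
        Precedes Φ x y
          ≈⟨ precedes-meet⇔ x∈V y∈V ⟩
        (WeaklyPrecedes ψ x y × WeaklyPrecedes φ x y × (Precedes ψ x y ⊎ Precedes φ x y))
          ≈⟨ weaklyPrecedes⇔ ×-⇔ weaklyPrecedes⇔ ×-⇔ (precedes⇔ ⊎-⇔ precedes⇔) ⟨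
        (x ≤[ ψ ] y × x ≤[ φ ] y × (x <[ ψ ] y ⊎ x <[ φ ] y))
          ∎

  -- The procedure Refine

  meetsᵇ-reflects : ∀ B C → Reflects (Any (_∈ C) B) (meetsᵇ B C)
  meetsᵇ-reflects B C = any-reflects (λ x → proof (x ∈? C)) B

  subsetᵇ-reflects : ∀ B C → Reflects (All (_∈ C) B) (subsetᵇ B C)
  subsetᵇ-reflects B C = all-reflects (λ x → proof (x ∈? C)) B

  isWLOᵇ-reflects : ∀ V Φ →
    Reflects (All (_≢ []) Φ × Unique (concat Φ) × All (_∈ V) (concat Φ) × All (_∈ concat Φ) V) (isWLOᵇ V Φ)
  isWLOᵇ-reflects V Φ =
    all-reflects (¬-reflects ∘ null-reflects) Φ ×-reflects proof (unique? (concat Φ)) ×-reflects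
    all-reflects (λ x → proof (x ∈? V)) (concat Φ) ×-reflects all-reflects (λ x → proof (x ∈? concat Φ)) V

  -- The final check (finalCheck) of refine.
  validate : List A → WeakOrder → Maybe WeakOrder
  validate V Φ = if isWLOᵇ V Φ then just Φ else nothing

  validate-accepts : ∀ {V Φ} → Unique V → IsWeakOrderOf V Φ → validate V Φ ≡ just Φ
  validate-accepts {V} {Φ} u w@(ne , Φ↭V) with isWLOᵇ V Φ | isWLOᵇ-reflects V Φ
  ... | true  | _      = refl
  ... | false | ofⁿ ¬w =
    ⊥-elim (¬w (ne , unique-concat u w , All.tabulate (∈-resp-↭ Φ↭V) ,
                All.tabulate (∈-resp-↭ (↭-sym Φ↭V))))

  validate-rejects : ∀ {V Φ x} → x ∈ V → x ∉ concat Φ → validate V Φ ≡ nothing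
  validate-rejects {V} {Φ} x∈V x∉Φ with isWLOᵇ V Φ | isWLOᵇ-reflects V Φ
  ... | true  | ofʸ (_ , _ , _ , covers) = ⊥-elim (x∉Φ (All.lookup covers x∈V))
  ... | false | _                        = refl

  LastMeetingSplit : List A → WeakOrder → Maybe WeakOrder → Set
  LastMeetingSplit C ψ nothing    = All (All (_∉ C)) ψ
  LastMeetingSplit C ψ (just pre) =
    ∃₂ λ Bmax post → ψ ≡ pre ++ Bmax ∷ post × Any (_∈ C) Bmax × All (All (_∉ C)) post

  blocksBeforeLastMeeting-split : ∀ C ψ → LastMeetingSplit C ψ (blocksBeforeLastMeeting C ψ)
  blocksBeforeLastMeeting-split C []      = []
  blocksBeforeLastMeeting-split C (B ∷ ψ) with blocksBeforeLastMeeting C ψ | blocksBeforeLastMeeting-split C ψ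
  ... | just pre | Bmax , post , refl , meets , avoid = Bmax , post , refl , meets , avoid
  ... | nothing  | avoid with meetsᵇ B C | meetsᵇ-reflects B C
  ...   | true  | ofʸ meets  = B , ψ , refl , meets , avoid
  ...   | false | ofⁿ ¬meets = ¬Any⇒All¬ B ¬meets ∷ avoid

  DownClosed : WeakOrder → List A → Set
  DownClosed ψ C = ∀ {x y} → Precedes ψ x y → y ∈ C → x ∈ C

  split-downClosed : ∀ {C} pre {B post} → All (All (_∈ C)) pre → All (All (_∉ C)) post →
                     DownClosed (pre ++ B ∷ post) C
  split-downClosed pre inC avoid p y∈C with precedes-++⁻ pre p
  ... | inj₁ q             = All.lookup (All.concat⁺ inC) (proj₁ (precedes⇒∈ q))
  ... | inj₂ (inj₁ (x∈ , _)) = All.lookup (All.concat⁺ inC) x∈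
  ... | inj₂ (inj₂ q)      = ⊥-elim (All.lookup (All.concat⁺ avoid) (precedes⇒∈later q) y∈C)

  head-meets : ∀ {V ψ C φ} → IsWeakOrderOf V ψ → IsWeakOrderOf V (C ∷ φ) → ¬ All (All (_∉ C)) ψ
  head-meets wψ wφ avoid =
    let c , c∈C = ≢[]⇒∈ _ (All.head (proj₁ wφ))
    in All.lookup (All.concat⁺ avoid) (∈V⇒∈concat wψ (∈-resp-↭ (proj₂ wφ) (∈-++⁺ˡ c∈C))) c∈C

  straddle⇒conflict : ∀ {V C φ} pre {Bmax post} →
                      IsWeakOrderOf V (pre ++ Bmax ∷ post) → IsWeakOrderOf V (C ∷ φ) →
                      Any (λ B → ¬ All (_∈ C) B) pre → Any (_∈ C) Bmax →
                      Conflict (pre ++ Bmax ∷ post) (C ∷ φ)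
  straddle⇒conflict {C = C} pre wψ wφ straddles meets =
    let z , z∈pre , z∉C = find (Any.concat⁺ (Any.map (¬All⇒Any¬ (_∈? C) _) straddles))
        x , x∈Bmax , x∈C = find meets
        z∈V = ∈-resp-↭ (proj₂ wψ) (∈-concat-++⁺ˡ pre z∈pre)
    in z , x , precedes-++⁺ pre z∈pre (∈-++⁺ˡ x∈Bmax) , first x∈C (∉head⇒∈tail wφ z∈V z∉C)

  RefineSpec : List A → WeakOrder → WeakOrder → Maybe WeakOrder → Set
  RefineSpec V ψ φ (just Φ) = IsMeet V ψ φ Φ
  RefineSpec V ψ φ nothing  = Conflict ψ φ

  validate-isMeet : ∀ {V ψ φ Φ} → Unique V → IsMeet V ψ φ Φ → RefineSpec V ψ φ (validate V Φ)
  validate-isMeet {V} {ψ} {φ} u meet = subst (RefineSpec V ψ φ) (sym (validate-accepts u (proj₁ meet))) meet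

  validate-conflict : ∀ {V ψ φ Φ x} → x ∈ V → x ∉ concat Φ → Conflict ψ φ →
                      RefineSpec V ψ φ (validate V Φ)
  validate-conflict {V} {ψ} {φ} x∈V x∉Φ = subst (RefineSpec V ψ φ) (sym (validate-rejects x∈V x∉Φ))

  module PeelFirstBlock {V ψ C φ′} (u : Unique V) (wψ : IsWeakOrderOf V ψ) (wφ : IsWeakOrderOf V (C ∷ φ′))
              (down : DownClosed ψ C) where

    open import Relation.Binary.Reasoning.Setoid (⇔-setoid 0ℓ)

    W : List A
    W = V ∖ C

    ∈W⁻ : ∀ {x} → x ∈ W → x ∈ V × x ∉ C
    ∈W⁻ = ∈-filter⁻ (λ x → ¬? (x ∈? C))

    ∈W⁺ : ∀ {x} → x ∈ V → x ∉ C → x ∈ W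
    ∈W⁺ = ∈-filter⁺ (λ x → ¬? (x ∈? C))

    ψC : WeakOrder
    ψC = restrict ψ C

    ∈ψC⇒∈C : ∀ {x} → x ∈ concat ψC → x ∈ C
    ∈ψC⇒∈C = ∈-concat-restrict⁻ ψ C

    ∉C⇒∈φ′ : ∀ {x} → x ∈ V → x ∉ C → x ∈ concat φ′
    ∉C⇒∈φ′ = ∉head⇒∈tail wφ

    ∈C⇒∉φ′ : ∀ {x} → x ∈ C → x ∉ concat φ′
    ∈C⇒∉φ′ = ++-disjoint C (unique-concat u wφ)

    weaklyPrecedes-fromC : ∀ {x y} → x ∈ C → y ∈ V → WeaklyPrecedes (C ∷ φ′) x y
    weaklyPrecedes-fromC {y = y} x∈C y∈V with y ∈? C
    ... | yes y∈C = inj₂ (here (x∈C , y∈C))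
    ... | no  y∉C = inj₁ (first x∈C (∉C⇒∈φ′ y∈V y∉C))

    ¬weaklyPrecedes-intoC : ∀ {x y} → x ∉ C → y ∈ C → ¬ WeaklyPrecedes (C ∷ φ′) x y
    ¬weaklyPrecedes-intoC x∉C y∈C (inj₁ (first x∈C _))    = x∉C x∈C
    ¬weaklyPrecedes-intoC x∉C y∈C (inj₁ (later p))        = ∈C⇒∉φ′ y∈C (proj₂ (precedes⇒∈ p))
    ¬weaklyPrecedes-intoC x∉C y∈C (inj₂ (here (x∈C , _))) = x∉C x∈C
    ¬weaklyPrecedes-intoC x∉C y∈C (inj₂ (there s))        = ∈C⇒∉φ′ y∈C (proj₂ (sameBlock⇒∈ s))

    module _ {R} (meetR : IsMeet W (restrict ψ W) (restrict (C ∷ φ′) W) R) where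

      Φ : WeakOrder
      Φ = ψC ++ R

      ∈R⇒∉C : ∀ {x} → x ∈ concat R → x ∉ C
      ∈R⇒∉C x∈R = proj₂ (∈W⁻ (∈-resp-↭ (proj₂ (proj₁ meetR)) x∈R))

      ∈R⁺ : ∀ {x} → x ∈ V → x ∉ C → x ∈ concat R
      ∈R⁺ x∈V x∉C = ∈-resp-↭ (↭-sym (proj₂ (proj₁ meetR))) (∈W⁺ x∈V x∉C)

      meet-inC : ∀ {x y} → y ∈ V → x ∈ C → y ∈ C →
                 WeaklyPrecedes Φ x y ⇔ (WeaklyPrecedes ψ x y × WeaklyPrecedes (C ∷ φ′) x y)
      meet-inC {x} {y} y∈V x∈C y∈C = begin
        WeaklyPrecedes Φ x y                                  ≈⟨ mk⇔ inψC weaklyPrecedes-++⁺ˡ ⟩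
        WeaklyPrecedes ψC x y                                 ≈⟨ weaklyPrecedes-restrict⇔ ψ C x∈C y∈C ⟩
        WeaklyPrecedes ψ x y                                  ≈⟨ mk⇔ (_, weaklyPrecedes-fromC x∈C y∈V) proj₁ ⟩
        (WeaklyPrecedes ψ x y × WeaklyPrecedes (C ∷ φ′) x y)  ∎
        where
        inψC : WeaklyPrecedes Φ x y → WeaklyPrecedes ψC x y
        inψC w with weaklyPrecedes-++⁻ ψC w
        ... | inj₁ w′               = w′
        ... | inj₂ (inj₁ (_ , y∈R)) = ⊥-elim (∈R⇒∉C y∈R y∈C)
        ... | inj₂ (inj₂ w′)        = ⊥-elim (∈R⇒∉C (proj₁ (weaklyPrecedes⇒∈ w′)) x∈C)

      meet-fromC : ∀ {x y} → x ∈ V → y ∈ V → x ∈ C → y ∉ C →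
                   WeaklyPrecedes Φ x y ⇔ (WeaklyPrecedes ψ x y × WeaklyPrecedes (C ∷ φ′) x y)
      meet-fromC {x} {y} x∈V y∈V x∈C y∉C =
        mk⇔ (const (x≼ψy , weaklyPrecedes-fromC x∈C y∈V)) (const x≼Φy)
        where
        x≼Φy : WeaklyPrecedes Φ x y
        x≼Φy = inj₁ (precedes-++⁺ ψC (∈-concat-restrict⁺ ψ C (∈V⇒∈concat wψ x∈V) x∈C) (∈R⁺ y∈V y∉C))
        x≼ψy : WeaklyPrecedes ψ x y
        x≼ψy = [ (λ w → w) , (λ p → ⊥-elim (y∉C (down p x∈C))) ]
               (weaklyPrecedes-total ψ (∈V⇒∈concat wψ x∈V) (∈V⇒∈concat wψ y∈V))

      meet-intoC : ∀ {x y} → x ∉ C → y ∈ C →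
                   WeaklyPrecedes Φ x y ⇔ (WeaklyPrecedes ψ x y × WeaklyPrecedes (C ∷ φ′) x y)
      meet-intoC {x} {y} x∉C y∈C =
        mk⇔ (⊥-elim ∘ x⋠Φy) (⊥-elim ∘ ¬weaklyPrecedes-intoC x∉C y∈C ∘ proj₂)
        where
        x⋠Φy : ¬ WeaklyPrecedes Φ x y
        x⋠Φy w with weaklyPrecedes-++⁻ ψC w
        ... | inj₁ w′                = x∉C (∈ψC⇒∈C (proj₁ (weaklyPrecedes⇒∈ w′)))
        ... | inj₂ (inj₁ (x∈ψC , _)) = x∉C (∈ψC⇒∈C x∈ψC)
        ... | inj₂ (inj₂ w′)         = ∈R⇒∉C (proj₂ (weaklyPrecedes⇒∈ w′)) y∈C

      meet-outsideC : ∀ {x y} → x ∈ V → y ∈ V → x ∉ C → y ∉ C →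
                      WeaklyPrecedes Φ x y ⇔ (WeaklyPrecedes ψ x y × WeaklyPrecedes (C ∷ φ′) x y)
      meet-outsideC {x} {y} x∈V y∈V x∉C y∉C = begin
        WeaklyPrecedes Φ x y
          ≈⟨ mk⇔ inR (weaklyPrecedes-++⁺ʳ ψC) ⟩
        WeaklyPrecedes R x y
          ≈⟨ proj₂ meetR x∈W y∈W ⟩
        (WeaklyPrecedes (restrict ψ W) x y × WeaklyPrecedes (restrict (C ∷ φ′) W) x y)
          ≈⟨ weaklyPrecedes-restrict⇔ ψ W x∈W y∈W ×-⇔ weaklyPrecedes-restrict⇔ (C ∷ φ′) W x∈W y∈W ⟩
        (WeaklyPrecedes ψ x y × WeaklyPrecedes (C ∷ φ′) x y)
          ∎
        where
        x∈W : x ∈ W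
        x∈W = ∈W⁺ x∈V x∉C
        y∈W : y ∈ W
        y∈W = ∈W⁺ y∈V y∉C
        inR : WeaklyPrecedes Φ x y → WeaklyPrecedes R x y
        inR w with weaklyPrecedes-++⁻ ψC w
        ... | inj₁ w′                = ⊥-elim (x∉C (∈ψC⇒∈C (proj₁ (weaklyPrecedes⇒∈ w′))))
        ... | inj₂ (inj₁ (x∈ψC , _)) = ⊥-elim (x∉C (∈ψC⇒∈C x∈ψC))
        ... | inj₂ (inj₂ w′)         = w′

      isMeet-++ : IsMeet V ψ (C ∷ φ′) Φ
      isMeet-++ = Product.map₂ (λ Φ↭ → ↭-trans Φ↭ (↭-sym (filter-++-filter-∁-↭ (_∈? C) V)))
                               (++-isWeakOrderOf (restrict-isWeakOrderOf C wψ) (proj₁ meetR))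
                , meet
        where
        meet : ∀ {x y} → x ∈ V → y ∈ V →
               WeaklyPrecedes Φ x y ⇔ (WeaklyPrecedes ψ x y × WeaklyPrecedes (C ∷ φ′) x y)
        meet {x} {y} x∈V y∈V with x ∈? C | y ∈? C
        ... | yes x∈C | yes y∈C = meet-inC y∈V x∈C y∈C
        ... | yes x∈C | no  y∉C = meet-fromC x∈V y∈V x∈C y∉C
        ... | no  x∉C | yes y∈C = meet-intoC x∉C y∈C
        ... | no  x∉C | no  y∉C = meet-outsideC x∈V y∈V x∉C y∉C

    refine-step : ∀ m → RefineSpec W (restrict ψ W) (restrict (C ∷ φ′) W) m →
                  RefineSpec V ψ (C ∷ φ′) (validate V (if null W then ψC else ψC ++ maybe (λ R → R) [] m))
    refine-step m spec with null W | null-reflects W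
    ... | true | ofʸ W≡[] = validate-isMeet u (subst (IsMeet V ψ (C ∷ φ′)) (++-identityʳ ψC) (isMeet-++ meet-[]))
      where
      meet-[] : IsMeet W (restrict ψ W) (restrict (C ∷ φ′) W) []
      meet-[] = subst (λ U → IsMeet U (restrict ψ W) (restrict (C ∷ φ′) W) []) (sym W≡[]) isMeet-[]
    refine-step (just R) spec | false | _ = validate-isMeet u (isMeet-++ spec)
    refine-step nothing  spec | false | ofⁿ W≢[] with ≢[]⇒∈ W W≢[]
    ... | w , w∈W = validate-conflict (proj₁ (∈W⁻ w∈W)) w∉Φ (conflict-restrict⁻ ψ (C ∷ φ′) W spec)
      where
      w∉Φ : w ∉ concat (ψC ++ [])
      w∉Φ w∈Φ with ∈-concat-++⁻ ψC w∈Φ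
      ... | inj₁ w∈ψC = proj₂ (∈W⁻ w∈W) (∈ψC⇒∈C w∈ψC)
      ... | inj₂ ()

  refine-spec : ∀ n {V ψ φ} → Unique V → IsWeakOrderOf V ψ → IsWeakOrderOf V φ → length φ ≤ n →
                RefineSpec V ψ φ (refine n V ψ φ)
  refine-spec n {φ = []} u wψ (_ , []↭V) _ with ↭-empty-inv (↭-sym []↭V)
  ... | refl = isMeet-[]
  refine-spec (suc n) {V} {ψ} {C ∷ φ′} u wψ wφ (s≤s length≤n)
    with blocksBeforeLastMeeting C ψ | blocksBeforeLastMeeting-split C ψ
  ... | nothing | avoid = ⊥-elim (head-meets wψ wφ avoid)
  ... | just pre | Bmax , post , refl , meets , avoid
    with any (λ B → not (subsetᵇ B C)) pre | any-reflects (λ B → ¬-reflects (subsetᵇ-reflects B C)) pre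
  ... | true  | ofʸ straddles = straddle⇒conflict pre wψ wφ straddles meets
  ... | false | ofⁿ ¬straddles =
    PeelFirstBlock.refine-step u wψ wφ (split-downClosed pre inC avoid)
      (refine n W (restrict ψ W) (restrict (C ∷ φ′) W))
      (refine-spec n (Unique.filter⁺ ∉C? u) (restrict-filter-isWeakOrderOf ∉C? wψ)
                     (restrict-filter-isWeakOrderOf ∉C? wφ) (≤-trans (length-restrict-∖ V C φ′) length≤n))
    where
    ∉C? : Decidable (_∉ C)
    ∉C? x = ¬? (x ∈? C)
    W : List A
    W = V ∖ C
    inC : All (All (_∈ C)) pre
    inC = All.map (λ {B} → decidable-stable (All.all? (_∈? C) B)) (¬Any⇒All¬ pre ¬straddles)

lemma4p3 : {A : Set} (_≟_ : DecidableEquality A) (V : List A) (ψ φ : List (List A)) →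
    Unique V → WLO.IsWLO _≟_ V ψ → WLO.IsWLO _≟_ V φ →
    ((Φ : List (List A)) → WLO.Refine _≟_ V ψ φ ≡ just Φ → WLO.IsCommonRefinement _≟_ V ψ φ Φ)
    × (WLO.Refine _≟_ V ψ φ ≡ nothing → ¬ WLO.Compatible _≟_ ψ φ)
lemma4p3 _≟_ V ψ φ u ψ-wlo φ-wlo =
  (λ Φ refines → isMeet⇒isCommonRefinement _≟_ u wψ wφ (subst (RefineSpec _≟_ V ψ φ) refines spec)) ,
  (λ fails → conflict⇒¬compatible _≟_ (subst (RefineSpec _≟_ V ψ φ) fails spec))
  where
  wψ : IsWeakOrderOf _≟_ V ψ
  wψ = to (isWLO⇔ _≟_) ψ-wlo
  wφ : IsWeakOrderOf _≟_ V φ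
  wφ = to (isWLO⇔ _≟_) φ-wlo
  spec : RefineSpec _≟_ V ψ φ (WLO.Refine _≟_ V ψ φ)
  spec = refine-spec _≟_ (length φ) u wψ wφ ≤-refl
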